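{- Let $X=\{1,-1\}$, let $\phi:X^*\to X^*$ be the monoid endomorphism with $\phi(1)=1\,1\,(-1)$ and $\phi(-1)=1\,(-1)\,(-1)$, and let $w_\alpha=\lim_{n\to\infty}\phi^n(1)$ (an infinite sequence over $X$, indexed from $0$). Consider the ternary finite automaton with final state output $\mathcal A_{0-2}$ having states $a_0,a_1,a_2$, initial state $a_1$, final state outputs $a_0\mapsto 1$, $a_1\mapsto 1$, $a_2\mapsto -1$, and transitions: from $a_1$, reading $0$ goes to $a_0$, reading $1$ stays at $a_1$, reading $2$ goes to $a_2$; the states $a_0$ and $a_2$ go to themselves on every input letter. Then $w_\alpha$ is a ternary automatic sequence; namely, it is the final state output sequence of $\mathcal A_{0-2}$: for every $i\ge0$, the $i$-th term of $w_\alpha$ equals the output of the state reached by $\mathcal A_{0-2}$ after reading, starting at $a_1$, a base-$3$ representation $i_0i_1\dots i_m$ of $i$ written least significant digit first ($i=\sum_j i_j3^j$).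
   Context: A $k$-ary finite automaton with final state output consists of a finite state set, input alphabet $\{0,\dots,k-1\}$, an output alphabet, an initial state, a transition map and a final state output map; its final state output sequence $(y_i)_{i\ge0}$ is given by $y_i=$ output of the state reached from the initial state after reading a base-$k$ representation of $i$ written least significant digit first (the result must not depend on the number of appended zero digits). A $k$-ary automatic sequence is a sequence obtainable this way. -}

module Defs where

open import Data.Nat using (ℕ; zero; suc; _+_; _*_)
open import Data.Fin using (Fin; zero; suc)
open import Data.List using (List; []; _∷_; [_]; concatMap; foldr)
open import Data.Sign using (Sign) renaming (+ to ⁺1; - to ⁻1)
open import Function using (_∘_)

-- The alphabet X = {1, -1} is represented by Data.Sign.Sign
-- (⁺1 stands for 1, ⁻1 stands for -1).
X : Set
X = Sign

φ-letter : X → List X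
φ-letter ⁺1 = ⁺1 ∷ ⁺1 ∷ ⁻1 ∷ []
φ-letter ⁻1 = ⁺1 ∷ ⁻1 ∷ ⁻1 ∷ []

φ : List X → List X
φ = concatMap φ-letter

φ^ : ℕ → List X → List X
φ^ zero    w = w
φ^ (suc n) w = φ (φ^ n w)

digitVal : Fin 3 → ℕ
digitVal zero          = 0
digitVal (suc zero)    = 1
digitVal (suc (suc _)) = 2

value₃ : List (Fin 3) → ℕ
value₃ = foldr (λ d v → digitVal d + 3 * v) 0

data State : Set where
  a₀ a₁ a₂ : State

δ : State → Fin 3 → State
δ a₁ zero          = a₀
δ a₁ (suc zero)    = a₁
δ a₁ (suc (suc _)) = a₂
δ a₀ _             = a₀
δ a₂ _             = a₂

out : State → X
out a₀ = ⁺1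
out a₁ = ⁺1
out a₂ = ⁻1

run : State → List (Fin 3) → State
run q []       = q
run q (d ∷ ds) = run (δ q d) ds

finalOutput : List (Fin 3) → X
finalOutput ds = out (run a₁ ds)

{-# OPTIONS --safe #-}
module Submission where

-- φ is 3-uniform, so letter r + 3q of φ(w) is letter r of φ(w_q).  The three
-- letters of φ(x) are 1, x, -1 for either x; hence a last digit 0 or 2 fixes
-- the letter outright, while digit 1 copies letter q of the previous iterate.
-- That is exactly the automaton: a₀ and a₂ are absorbing with outputs 1 and
-- -1, and a₁ stays put on 1.  Induction on n shows that every letter of
-- φ^n(1) is the automaton's output, and |φ^n(1)| = 3^n exhausts all indices.

open import Defs
open import Data.Fin using (Fin; zero; suc; fromℕ<)
open import Data.List using (List; []; _∷_; [_]; _++_; concatMap; length; lookup)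
open import Data.List.Properties using (length-++)
open import Data.Maybe using (Maybe; nothing; just; _>>=_)
open import Data.Maybe.Properties using (just-injective)
open import Data.Nat using (ℕ; zero; suc; _+_; _*_; _^_; _<_; z<s; s<s)
open import Data.Nat.Properties
  using (+-commutativeSemigroup; +-identityʳ; *-zeroʳ; *-suc; ≤-<-trans; n<1+n; ^-monoʳ-<)
open import Algebra.Properties.CommutativeSemigroup +-commutativeSemigroup using (x∙yz≈y∙xz)
open import Data.Product using (_×_; ∃; _,_)
open import Data.Sign using () renaming (+ to ⁺1; - to ⁻1)
open import Relation.Binary.PropositionalEquality
  using (_≡_; refl; sym; trans; cong; cong₂; subst; module ≡-Reasoning)
open ≡-Reasoning

private
  variable
    A B : Set

n<m^n : ∀ m → 1 < m → ∀ n → n < m ^ n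
n<m^n m 1<m zero    = z<s
n<m^n m 1<m (suc n) = ≤-<-trans (n<m^n m 1<m n) (^-monoʳ-< m 1<m (n<1+n n))

_!?_ : List A → ℕ → Maybe A
[]       !? _     = nothing
(x ∷ xs) !? zero  = just x
(x ∷ xs) !? suc i = xs !? i

!?-lookup : (xs : List A) {i : ℕ} (i<n : i < length xs) →
            xs !? i ≡ just (lookup xs (fromℕ< i<n))
!?-lookup (x ∷ xs) {zero}  _         = refl
!?-lookup (x ∷ xs) {suc i} (s<s i<n) = !?-lookup xs i<n

!?-[_] : ∀ (y : A) i {x} → [ y ] !? i ≡ just x → x ≡ y
!?-[ y ] zero refl = refl

++-!?ˡ : (xs : List A) {ys : List A} {i : ℕ} → i < length xs → (xs ++ ys) !? i ≡ xs !? i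
++-!?ˡ (x ∷ xs) {i = zero}  _         = refl
++-!?ˡ (x ∷ xs) {i = suc i} (s<s i<n) = ++-!?ˡ xs i<n

++-!?ʳ : (xs : List A) {ys : List A} (i : ℕ) → (xs ++ ys) !? (length xs + i) ≡ ys !? i
++-!?ʳ []       i = refl
++-!?ʳ (x ∷ xs) i = ++-!?ʳ xs i

module _ {k : ℕ} (f : A → List B) (uniform : ∀ x → length (f x) ≡ k) where

  length-concatMap-uniform : ∀ w → length (concatMap f w) ≡ k * length w
  length-concatMap-uniform []      = sym (*-zeroʳ k)
  length-concatMap-uniform (x ∷ w) = begin
    length (f x ++ concatMap f w)            ≡⟨ length-++ (f x) ⟩
    length (f x) + length (concatMap f w)    ≡⟨ cong₂ _+_ (uniform x) (length-concatMap-uniform w) ⟩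
    k + k * length w                         ≡⟨ sym (*-suc k (length w)) ⟩
    k * length (x ∷ w)                       ∎

  concatMap-uniform-!? : ∀ {r} → r < k → ∀ w q →
                         concatMap f w !? (r + k * q) ≡ (w !? q >>= λ x → f x !? r)
  concatMap-uniform-!? r<k []      q = refl
  concatMap-uniform-!? {r} r<k (x ∷ w) zero = begin
    (f x ++ concatMap f w) !? (r + k * 0)  ≡⟨ cong ((f x ++ concatMap f w) !?_) (trans (cong (r +_) (*-zeroʳ k)) (+-identityʳ r)) ⟩
    (f x ++ concatMap f w) !? r            ≡⟨ ++-!?ˡ (f x) (subst (r <_) (sym (uniform x)) r<k) ⟩
    f x !? r                               ∎
  concatMap-uniform-!? {r} r<k (x ∷ w) (suc q) = begin
    (f x ++ concatMap f w) !? (r + k * suc q)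
      ≡⟨ cong ((f x ++ concatMap f w) !?_) (trans (cong (r +_) (*-suc k q)) (x∙yz≈y∙xz r k (k * q))) ⟩
    (f x ++ concatMap f w) !? (k + (r + k * q))
      ≡⟨ cong (λ l → (f x ++ concatMap f w) !? (l + (r + k * q))) (sym (uniform x)) ⟩
    (f x ++ concatMap f w) !? (length (f x) + (r + k * q))
      ≡⟨ ++-!?ʳ (f x) (r + k * q) ⟩
    concatMap f w !? (r + k * q)
      ≡⟨ concatMap-uniform-!? r<k w q ⟩
    (w !? q >>= λ y → f y !? r) ∎

length-φ-letter : ∀ x → length (φ-letter x) ≡ 3
length-φ-letter ⁺1 = refl
length-φ-letter ⁻1 = refl

length-φ^ : ∀ n → length (φ^ n [ ⁺1 ]) ≡ 3 ^ n
length-φ^ zero    = refl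
length-φ^ (suc n) = trans (length-concatMap-uniform φ-letter length-φ-letter (φ^ n [ ⁺1 ]))
                          (cong (3 *_) (length-φ^ n))

letter : Fin 3 → X → X
letter zero          _ = ⁺1
letter (suc zero)    x = x
letter (suc (suc _)) _ = ⁻1

φ-letter-!? : ∀ x d → φ-letter x !? digitVal d ≡ just (letter d x)
φ-letter-!? ⁺1 zero             = refl
φ-letter-!? ⁺1 (suc zero)       = refl
φ-letter-!? ⁺1 (suc (suc zero)) = refl
φ-letter-!? ⁻1 zero             = refl
φ-letter-!? ⁻1 (suc zero)       = refl
φ-letter-!? ⁻1 (suc (suc zero)) = refl

digitVal<3 : ∀ d → digitVal d < 3
digitVal<3 zero             = z<s
digitVal<3 (suc zero)       = s<s z<s
digitVal<3 (suc (suc zero)) = s<s (s<s z<s)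

φ-!? : ∀ w d q {x} → φ w !? (digitVal d + 3 * q) ≡ just x →
       ∃ λ y → w !? q ≡ just y × x ≡ letter d y
φ-!? w d q eq with w !? q
                 | trans (sym (concatMap-uniform-!? φ-letter length-φ-letter (digitVal<3 d) w q)) eq
... | just y | letter-y = y , refl , just-injective (trans (sym letter-y) (φ-letter-!? y d))

run-absorbing : ∀ {q} → (∀ d → δ q d ≡ q) → ∀ ds → run q ds ≡ q
run-absorbing fixed []       = refl
run-absorbing fixed (d ∷ ds) rewrite fixed d = run-absorbing fixed ds

finalOutput-∷ : ∀ d ds → finalOutput (d ∷ ds) ≡ letter d (finalOutput ds)
finalOutput-∷ zero             ds = cong out (run-absorbing (λ _ → refl) ds)
finalOutput-∷ (suc zero)       ds = refl
finalOutput-∷ (suc (suc zero)) ds = cong out (run-absorbing (λ _ → refl) ds)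

MatchesAutomaton : List X → Set
MatchesAutomaton w = ∀ ds {x} → w !? value₃ ds ≡ just x → x ≡ finalOutput ds

[⁺1]-matches : MatchesAutomaton [ ⁺1 ]
[⁺1]-matches []                    refl = refl
[⁺1]-matches (zero ∷ ds)           eq   = trans (!?-[ ⁺1 ] (3 * value₃ ds) eq) (sym (finalOutput-∷ zero ds))
[⁺1]-matches (suc zero ∷ ds)       ()
[⁺1]-matches (suc (suc zero) ∷ ds) ()

φ-matches : ∀ {w} → MatchesAutomaton w → MatchesAutomaton (φ w)
φ-matches {w} matches [] eq with φ-!? w zero 0 eq
... | _ , _ , x≡⁺1 = x≡⁺1
φ-matches {w} matches (d ∷ ds) {x} eq with φ-!? w d (value₃ ds) eq
... | y , w!?q≡y , x≡letter = begin
  x                         ≡⟨ x≡letter ⟩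
  letter d y                ≡⟨ cong (letter d) (matches ds w!?q≡y) ⟩
  letter d (finalOutput ds) ≡⟨ finalOutput-∷ d ds ⟨
  finalOutput (d ∷ ds)      ∎

φ^-matches : ∀ n → MatchesAutomaton (φ^ n [ ⁺1 ])
φ^-matches zero    = [⁺1]-matches
φ^-matches (suc n) = φ-matches {φ^ n [ ⁺1 ]} (φ^-matches n)

mainTheorem3 : ((i : ℕ) → ∃ λ n → i < length (φ^ n [ ⁺1 ])) ×
    ((n i : ℕ) (h : i < length (φ^ n [ ⁺1 ])) (ds : List (Fin 3)) →
      value₃ ds ≡ i → lookup (φ^ n [ ⁺1 ]) (fromℕ< h) ≡ finalOutput ds)
mainTheorem3 = covers , agrees
  where
  covers : (i : ℕ) → ∃ λ n → i < length (φ^ n [ ⁺1 ])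
  covers i = i , subst (i <_) (sym (length-φ^ i)) (n<m^n 3 (s<s z<s) i)

  agrees : (n i : ℕ) (h : i < length (φ^ n [ ⁺1 ])) (ds : List (Fin 3)) →
           value₃ ds ≡ i → lookup (φ^ n [ ⁺1 ]) (fromℕ< h) ≡ finalOutput ds
  agrees n _ h ds refl = φ^-matches n ds (!?-lookup (φ^ n [ ⁺1 ]) h)
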